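{- Let $\Delta \geq 4$ be an even integer with $\Delta \equiv 2 \pmod 3$. For the following vectors $a,b \in \mathbb{Z}^3$ the matrix $M(a,b)$ is $\Delta$-modular and has $\Delta + 4$ columns: \begin{enumerate} \item[(i)] If $\Delta = 12 s + 2$ for some nonnegative integer $s$, let $a = (0,4 s + 1, 9 s + 1)^\intercal$ and $b = (7 s + 1, 10 s + 1, 12 s + 2)^\intercal$. \item[(ii)] If $\Delta = 12 s + 8$ for some nonnegative integer $s$, let $a = (0,4 s + 3, 9 s + 7)^\intercal$ and $b = (7 s + 5, 10 s + 7, 12 s + 8)^\intercal$. \end{enumerate}
   Context: For $m\in\mathbb{Z}_{>0}$ and $a,b\in\mathbb{Z}^m$ with $a_j\le b_j$ for all $j$, $M(a,b)$ denotes the $2$-row integer matrix whose columns are $(0,1)^\intercal$ together with, for each $j=1,\dots,m$, all vectors $(j,k)^\intercal$ with $k$ an integer satisfying $a_j\le k\le b_j$ and $\gcd(j,k)=1$. A matrix $A\in\mathbb{Z}^{r\times n}$ is $\Delta$-modular if all its $\operatorname{rank}(A)\times\operatorname{rank}(A)$ minors (determinants of square submatrices) have absolute value at most $\Delta$ and at least one equals $\pm\Delta$. -}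

module Defs where

open import Data.Nat as ℕ using (ℕ; zero; suc)
open import Data.Integer as ℤ using (ℤ; +_; _-_; ∣_∣)
open import Data.Integer.GCD using (gcd)
open import Data.Product using (_×_; _,_)
open import Data.List using (List; []; _∷_; map; upTo; concatMap; filter; _++_; allFin)
open import Data.Bool.ListAction using (any)
open import Data.List.Relation.Unary.All using (All)
open import Data.List.Relation.Unary.Any using (Any)
open import Data.Fin using (Fin; toℕ)
open import Data.Vec using (Vec; lookup)
open import Data.Bool using (Bool; true; false; if_then_else_; not)
open import Relation.Nullary.Decidable using (⌊_⌋)
open import Relation.Binary.PropositionalEquality using (_≡_)

-- A 2-row integer matrix, represented by its list of columns (top entry, bottom entry).
Column : Set
Column = ℤ × ℤ

Matrix2 : Set
Matrix2 = List Column

intRange : ℤ → ℤ → List ℤ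
intRange a b with ⌊ a ℤ.≤? b ⌋
... | true  = map (λ i → a ℤ.+ + i) (upTo (suc ∣ b - a ∣))
... | false = []

M : {m : ℕ} → Vec ℤ m → Vec ℤ m → Matrix2
M {m} a b = (+ 0 , + 1) ∷ concatMap cols (allFin m)
  where
  cols : Fin m → List Column
  cols i = map (λ k → (j , k))
               (filter (λ k → gcd j k ℤ.≟ + 1) (intRange (lookup a i) (lookup b i)))
    where j = + suc (toℕ i)

numColumns : Matrix2 → ℕ
numColumns = Data.List.length

det2 : Column → Column → ℤ
det2 (x₁ , y₁) (x₂ , y₂) = x₁ ℤ.* y₂ - x₂ ℤ.* y₁

pairs : {A : Set} → List A → List (A × A)
pairs [] = []
pairs (x ∷ xs) = map (λ y → (x , y)) xs ++ pairs xs

minors2 : Matrix2 → List ℤ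
minors2 A = map (λ p → det2 (Data.Product.proj₁ p) (Data.Product.proj₂ p)) (pairs A)

minors1 : Matrix2 → List ℤ
minors1 A = concatMap (λ c → Data.Product.proj₁ c ∷ Data.Product.proj₂ c ∷ []) A

nonzero : ℤ → Bool
nonzero z = not ⌊ z ℤ.≟ + 0 ⌋

rank : Matrix2 → ℕ
rank A = if any nonzero (minors2 A) then 2
         else if any nonzero (minors1 A) then 1 else 0

-- all r×r minors (the empty 0×0 minor has determinant 1)
minors : ℕ → Matrix2 → List ℤ
minors 0 A = + 1 ∷ []
minors 1 A = minors1 A
minors 2 A = minors2 A
minors (suc (suc (suc _))) A = []

ΔModular : Matrix2 → ℕ → Set
ΔModular A Δ = All (λ d → ∣ d ∣ ℕ.≤ Δ) (minors (rank A) A)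
             × Any (λ d → ∣ d ∣ ≡ Δ) (minors (rank A) A)

-- M(a, b) is the column (0, 1) together with, for j = 1, 2, 3, the strip of columns (j, k), aⱼ ≤ k ≤ bⱼ,
-- gcd(j, k) = 1. The minor j k′ − j′ k of two columns is monotone in k and k′, so it is bounded by Δ as soon
-- as it is at the corners of the boxes [aⱼ, bⱼ] × [aⱼ′, bⱼ′]: sixteen inequalities, affine in s, checked on
-- their coefficients. The bound is attained by (1, b₁) and (3, a₃), since 3 b₁ − a₃ = Δ. For the count,
-- coprimality to j is periodic mod j, and each strip has length d j s + r from a start c j s + q, so it
-- contains d s times as many columns as one period, plus those among r residues.

module Submission where

open import Defs
open import Algebra.Properties.CommutativeSemigroup using (interchange; x∙yz≈y∙xz; xy∙z≈xz∙y)
open import Data.Empty using (⊥-elim)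
open import Data.Fin using (Fin; zero; suc; toℕ)
open import Data.Fin.Properties using (all?)
open import Data.Integer as ℤ using (ℤ; +_; ∣_∣; _⊖_)
open import Data.Integer.GCD using (gcd)
open import Data.Integer.Properties using ([+m]-[+n]≡m⊖n; pos-*; ⊖-≥; ∣⊖∣-≤; ∣m⊖n∣≡∣n⊖m∣; ∣i-j∣≡∣j-i∣)
open import Data.List using (List; []; _∷_; _++_; map; filter; applyUpTo; length; allFin; concatMap)
open import Data.Nat.ListAction using (sum)
open import Data.List.Properties using (length-++; length-map; filter-++; filter-accept; filter-reject; map-upTo; map-cong)
open import Data.List.Membership.Propositional using (_∈_)
open import Data.List.Membership.Propositional.Properties
  using (∈-map⁺; ∈-map⁻; ∈-filter⁺; ∈-filter⁻; ∈-++⁺ˡ; ∈-++⁺ʳ; ∈-applyUpTo⁺; ∈-applyUpTo⁻; ∈-concatMap⁺; ∈-concatMap⁻; ∈-allFin)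
open import Data.List.Relation.Unary.All as All using (All)
open import Data.List.Relation.Unary.All.Properties using (++⁺; map⁺)
open import Data.List.Relation.Unary.Any as Any using (Any; here; there)
open import Data.Nat as ℕ using (ℕ; zero; suc; _+_; _*_; _∸_; _≤_; _<_; _≥_; _%_; _≤?_; z≤n; s≤s)
open import Data.Nat.Divisibility using (_∣_)
open import Data.Nat.GCD using (GCD; gcd-GCD; gcd-zeroˡ) renaming (gcd to gcdℕ)
open import Data.Nat.Properties
  using (≤-refl; ≤-trans; ≤-total; ≤-pred; ≰⇒>; n≮0; 0∸n≡0; m≤m+n; m+n∸m≡n; m+[n∸m]≡n; m≤n⇒m∸n≡0; +-∸-assoc;
         m≤n+o⇒m∸n≤o; ∸-monoˡ-<; +-assoc; +-suc; +-mono-≤; +-monoˡ-≤; *-monoʳ-≤; *-monoˡ-≤;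
         *-assoc; *-distribˡ-+; *-distribʳ-+; +-commutativeSemigroup; *-commutativeSemigroup)
open import Data.Nat.Tactic.RingSolver using (solve-∀)
open import Data.Product using (_×_; _,_; ∃; ∃₂; proj₁; proj₂; uncurry)
open import Data.Sum as Sum using (_⊎_; inj₁; inj₂)
open import Data.Vec as Vec using (Vec; []; _∷_; lookup)
open import Data.Vec.Properties using (lookup-map)
open import Function using (_∘_)
open import Relation.Nullary using (Dec; yes; no)
open import Relation.Nullary.Decidable using (from-yes; _×-dec_)
open import Relation.Unary using (Decidable)
open import Relation.Binary.PropositionalEquality
  using (_≡_; _≢_; refl; sym; trans; cong; cong₂; subst; subst₂; module ≡-Reasoning)

open ≡-Reasoning

m+[n+o]≡n+[m+o] : ∀ m n o → m + (n + o) ≡ n + (m + o)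
m+[n+o]≡n+[m+o] = x∙yz≈y∙xz +-commutativeSemigroup

m*n*o≡m*o*n : ∀ m n o → m * n * o ≡ m * o * n
m*n*o≡m*o*n = xy∙z≈xz∙y *-commutativeSemigroup

m<1+n∸o⇒o+m≤n : ∀ o n {m} → m < suc n ∸ o → o + m ≤ n
m<1+n∸o⇒o+m≤n zero    n       m<1+n = ≤-pred m<1+n
m<1+n∸o⇒o+m≤n (suc o) (suc n) m<    = s≤s (m<1+n∸o⇒o+m≤n o n m<)
m<1+n∸o⇒o+m≤n (suc o) zero {m} m< = ⊥-elim (n≮0 (subst (m <_) (0∸n≡0 o) m<))

∣m⊖n∣≤ : ∀ m n {D} → m ≤ n + D → n ≤ m + D → ∣ m ⊖ n ∣ ≤ D
∣m⊖n∣≤ m n {D} m≤n+D n≤m+D with ≤-total m n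
... | inj₁ m≤n = subst (_≤ D) (sym (∣⊖∣-≤ m≤n)) (m≤n+o⇒m∸n≤o n m n≤m+D)
... | inj₂ n≤m = subst (_≤ D) (trans (sym (∣⊖∣-≤ n≤m)) (∣m⊖n∣≡∣n⊖m∣ n m)) (m≤n+o⇒m∸n≤o m n m≤n+D)

∣m⊖n∣≡ : ∀ {m n D} → n ≡ m + D → ∣ m ⊖ n ∣ ≡ D
∣m⊖n∣≡ {m} {D = D} refl = trans (∣⊖∣-≤ (m≤m+n m D)) (m+n∸m≡n m D)

gcd[m,m+n]≡gcd[m,n] : ∀ m n → gcdℕ m (m + n) ≡ gcdℕ m n
gcd[m,m+n]≡gcd[m,n] m n = GCD.unique (gcd-GCD m (m + n)) (GCD.step (gcd-GCD m n))

gcd[m,k*m+n]≡gcd[m,n] : ∀ k m n → gcdℕ m (k * m + n) ≡ gcdℕ m n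
gcd[m,k*m+n]≡gcd[m,n] zero    m n = refl
gcd[m,k*m+n]≡gcd[m,n] (suc k) m n = begin
  gcdℕ m (m + k * m + n)   ≡⟨ cong (gcdℕ m) (+-assoc m (k * m) n) ⟩
  gcdℕ m (m + (k * m + n)) ≡⟨ gcd[m,m+n]≡gcd[m,n] m (k * m + n) ⟩
  gcdℕ m (k * m + n)       ≡⟨ gcd[m,k*m+n]≡gcd[m,n] k m n ⟩
  gcdℕ m n                 ∎

gcd[j,c*j*s+q]≡gcd[j,q] : ∀ j c s q → gcdℕ j (c * j * s + q) ≡ gcdℕ j q
gcd[j,c*j*s+q]≡gcd[j,q] j c s q = begin
  gcdℕ j (c * j * s + q) ≡⟨ cong (λ x → gcdℕ j (x + q)) (m*n*o≡m*o*n c j s) ⟩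
  gcdℕ j (c * s * j + q) ≡⟨ gcd[m,k*m+n]≡gcd[m,n] (c * s) j q ⟩
  gcdℕ j q               ∎

applyUpTo-+ : ∀ {A : Set} (f : ℕ → A) m n → applyUpTo f (m + n) ≡ applyUpTo f m ++ applyUpTo (λ i → f (m + i)) n
applyUpTo-+ f zero    n = refl
applyUpTo-+ f (suc m) n = cong (f 0 ∷_) (applyUpTo-+ (f ∘ suc) m n)

length-concatMap : ∀ {A B : Set} (f : A → List B) xs → length (concatMap f xs) ≡ sum (map (length ∘ f) xs)
length-concatMap f []       = refl
length-concatMap f (x ∷ xs) = trans (length-++ (f x)) (cong (length (f x) ℕ.+_) (length-concatMap f xs))

pairs-All : ∀ {A : Set} {P : A → A → Set} xs → (∀ {x y} → x ∈ xs → y ∈ xs → P x y) → All (uncurry P) (pairs xs)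
pairs-All []       _ = All.[]
pairs-All (x ∷ xs) h = ++⁺ (map⁺ (All.tabulate (λ y∈ → h (here refl) (there y∈))))
                           (pairs-All xs (λ x∈ y∈ → h (there x∈) (there y∈)))

∈-pairs : ∀ {A : Set} {xs : List A} {x y} → x ∈ xs → y ∈ xs → x ≢ y → (x , y) ∈ pairs xs ⊎ (y , x) ∈ pairs xs
∈-pairs (here refl) (here refl) x≢y = ⊥-elim (x≢y refl)
∈-pairs {x = x} (here refl) (there y∈) _ = inj₁ (∈-++⁺ˡ (∈-map⁺ (x ,_) y∈))
∈-pairs {y = y} (there x∈) (here refl) _ = inj₂ (∈-++⁺ˡ (∈-map⁺ (y ,_) x∈))
∈-pairs {xs = z ∷ zs} (there x∈) (there y∈) x≢y = Sum.map (∈-++⁺ʳ _) (∈-++⁺ʳ _) (∈-pairs x∈ y∈ x≢y)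

CoprimeTo : ℕ → ℤ → Set
CoprimeTo j k = gcd (+ j) k ≡ + 1

coprimeTo? : ∀ j → Decidable (CoprimeTo j)
coprimeTo? j k = gcd (+ j) k ℤ.≟ + 1

countCoprime : ℕ → (ℕ → ℕ) → ℕ → ℕ
countCoprime j f n = length (filter (coprimeTo? j) (applyUpTo (λ i → + f i) n))

coprimesFrom : ℕ → ℕ → ℕ → ℕ
coprimesFrom j lo = countCoprime j (λ i → lo + i)

countCoprime-cong : ∀ j {f g} n → (∀ i → gcdℕ j (f i) ≡ gcdℕ j (g i)) →
                    countCoprime j f n ≡ countCoprime j g n
countCoprime-cong j zero eq = refl
countCoprime-cong j {f} {g} (suc n) eq with coprimeTo? j (+ g 0)
... | yes g₀ = begin
  countCoprime j f (suc n)         ≡⟨ cong length (filter-accept (coprimeTo? j) (trans (cong +_ (eq 0)) g₀)) ⟩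
  suc (countCoprime j (f ∘ suc) n) ≡⟨ cong suc (countCoprime-cong j n (eq ∘ suc)) ⟩
  suc (countCoprime j (g ∘ suc) n) ≡⟨ cong length (filter-accept (coprimeTo? j) g₀) ⟨
  countCoprime j g (suc n)         ∎
... | no ¬g₀ = begin
  countCoprime j f (suc n)         ≡⟨ cong length (filter-reject (coprimeTo? j) (¬g₀ ∘ trans (cong +_ (sym (eq 0))))) ⟩
  countCoprime j (f ∘ suc) n       ≡⟨ countCoprime-cong j n (eq ∘ suc) ⟩
  countCoprime j (g ∘ suc) n       ≡⟨ cong length (filter-reject (coprimeTo? j) ¬g₀) ⟨
  countCoprime j g (suc n)         ∎

countCoprime-+ : ∀ j f m n → countCoprime j f (m + n) ≡ countCoprime j f m + countCoprime j (λ i → f (m + i)) n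
countCoprime-+ j f m n = begin
  length (filter P (applyUpTo g (m + n)))        ≡⟨ cong (length ∘ filter P) (applyUpTo-+ g m n) ⟩
  length (filter P (xs ++ ys))                   ≡⟨ cong length (filter-++ P xs ys) ⟩
  length (filter P xs ++ filter P ys)            ≡⟨ length-++ (filter P xs) ⟩
  length (filter P xs) + length (filter P ys)    ∎
  where
  P = coprimeTo? j
  g = λ i → + f i
  xs = applyUpTo g m
  ys = applyUpTo (λ i → g (m + i)) n

coprimesFrom-blocks : ∀ j r k n → coprimesFrom j r (k * j + n) ≡ k * coprimesFrom j r j + coprimesFrom j r n
coprimesFrom-blocks j r zero    n = refl
coprimesFrom-blocks j r (suc k) n = begin
  coprimesFrom j r (j + k * j + n)                          ≡⟨ cong (coprimesFrom j r) (+-assoc j (k * j) n) ⟩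
  coprimesFrom j r (j + (k * j + n))                        ≡⟨ countCoprime-+ j (λ i → r + i) j (k * j + n) ⟩
  c + countCoprime j (λ i → r + (j + i)) (k * j + n)        ≡⟨ cong (c ℕ.+_) (countCoprime-cong j (k * j + n) shift) ⟩
  c + coprimesFrom j r (k * j + n)                          ≡⟨ cong (c ℕ.+_) (coprimesFrom-blocks j r k n) ⟩
  c + (k * c + coprimesFrom j r n)                          ≡⟨ +-assoc c (k * c) _ ⟨
  c + k * c + coprimesFrom j r n                            ∎
  where
  c = coprimesFrom j r j
  shift : ∀ i → gcdℕ j (r + (j + i)) ≡ gcdℕ j (r + i)
  shift i = trans (cong (gcdℕ j) (m+[n+o]≡n+[m+o] r j i)) (gcd[m,m+n]≡gcd[m,n] j (r + i))

coprimesFrom-affine : ∀ j c d q r s →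
  coprimesFrom j (c * j * s + q) (d * j * s + r) ≡ d * s * coprimesFrom j q j + coprimesFrom j q r
coprimesFrom-affine j c d q r s = begin
  coprimesFrom j (c * j * s + q) (d * j * s + r)   ≡⟨ countCoprime-cong j (d * j * s + r) periodic ⟩
  coprimesFrom j q (d * j * s + r)                 ≡⟨ cong (λ x → coprimesFrom j q (x + r)) (m*n*o≡m*o*n d j s) ⟩
  coprimesFrom j q (d * s * j + r)                 ≡⟨ coprimesFrom-blocks j q (d * s) r ⟩
  d * s * coprimesFrom j q j + coprimesFrom j q r  ∎
  where
  periodic : ∀ i → gcdℕ j (c * j * s + q + i) ≡ gcdℕ j (q + i)
  periodic i = trans (cong (gcdℕ j) (+-assoc (c * j * s) q i)) (gcd[j,c*j*s+q]≡gcd[j,q] j c s (q + i))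

record Affine : Set where
  constructor _s+_
  field
    slope offset : ℕ

open Affine

infix  8 _s+_
infixr 7 _⊛_
infixl 6 _⊕_
infix  4 _≤[_]_ _≤[_]?_

⟦_⟧ : Affine → ℕ → ℕ
⟦ p s+ q ⟧ s = p * s + q

⟦_⟧ᵥ : ∀ {m} → Vec Affine m → ℕ → Vec ℕ m
⟦ fs ⟧ᵥ s = Vec.map (λ f → ⟦ f ⟧ s) fs

_⊛_ : ℕ → Affine → Affine
j ⊛ (p s+ q) = (j * p) s+ (j * q)

_⊕_ : Affine → Affine → Affine
(p s+ q) ⊕ (p′ s+ q′) = (p + p′) s+ (q + q′)

⟦⊛⟧ : ∀ j f s → ⟦ j ⊛ f ⟧ s ≡ j * ⟦ f ⟧ s
⟦⊛⟧ j (p s+ q) s = begin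
  j * p * s + j * q   ≡⟨ cong (_+ j * q) (*-assoc j p s) ⟩
  j * (p * s) + j * q ≡⟨ *-distribˡ-+ j (p * s) q ⟨
  j * (p * s + q)     ∎

⟦⊕⟧ : ∀ f g s → ⟦ f ⊕ g ⟧ s ≡ ⟦ f ⟧ s + ⟦ g ⟧ s
⟦⊕⟧ (p s+ q) (p′ s+ q′) s = begin
  (p + p′) * s + (q + q′)     ≡⟨ cong (_+ (q + q′)) (*-distribʳ-+ s p p′) ⟩
  p * s + p′ * s + (q + q′)   ≡⟨ interchange +-commutativeSemigroup (p * s) (p′ * s) q q′ ⟩
  p * s + q + (p′ * s + q′)   ∎

⟦⟧-shift : ∀ f n u → ⟦ f ⟧ (n + u) ≡ ⟦ f ⟧ n + slope f * u
⟦⟧-shift (p s+ q) n u = begin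
  p * (n + u) + q     ≡⟨ cong (_+ q) (*-distribˡ-+ p n u) ⟩
  p * n + p * u + q   ≡⟨ xy∙z≈xz∙y +-commutativeSemigroup (p * n) (p * u) q ⟩
  p * n + q + p * u   ∎

-- A coefficientwise certificate that f ≤ g on [n, ∞); being decidable, it is discharged by evaluation.
_≤[_]_ : Affine → ℕ → Affine → Set
f ≤[ n ] g = slope f ≤ slope g × ⟦ f ⟧ n ≤ ⟦ g ⟧ n

_≤[_]?_ : ∀ f n g → Dec (f ≤[ n ] g)
f ≤[ n ]? g = (slope f ≤? slope g) ×-dec (⟦ f ⟧ n ≤? ⟦ g ⟧ n)

≤[]⇒≤ : ∀ {f g n s} → f ≤[ n ] g → n ≤ s → ⟦ f ⟧ s ≤ ⟦ g ⟧ s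
≤[]⇒≤ {f} {g} {n} {s} (slope≤ , value≤) n≤s = subst (λ x → ⟦ f ⟧ x ≤ ⟦ g ⟧ x) (m+[n∸m]≡n n≤s)
  (subst₂ _≤_ (sym (⟦⟧-shift f n (s ∸ n))) (sym (⟦⟧-shift g n (s ∸ n)))
    (+-mono-≤ value≤ (*-monoˡ-≤ (s ∸ n) slope≤)))

intRange-+ : ∀ lo hi → intRange (+ lo) (+ hi) ≡ applyUpTo (λ i → + (lo + i)) (suc hi ∸ lo)
intRange-+ lo hi with + lo ℤ.≤? + hi
... | yes (ℤ.+≤+ lo≤hi) =
  trans (map-upTo _ _) (cong (applyUpTo _) (trans (cong suc width) (sym (+-∸-assoc 1 lo≤hi))))
  where
  width : ∣ + hi ℤ.- + lo ∣ ≡ hi ∸ lo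
  width = trans (cong ∣_∣ ([+m]-[+n]≡m⊖n hi lo)) (cong ∣_∣ (⊖-≥ lo≤hi))
... | no lo≰hi = cong (applyUpTo _) (sym (m≤n⇒m∸n≡0 (≰⇒> (lo≰hi ∘ ℤ.+≤+))))

∈-intRange⁻ : ∀ {lo hi y} → y ∈ intRange (+ lo) (+ hi) → ∃ λ k → y ≡ + k × lo ≤ k × k ≤ hi
∈-intRange⁻ {lo} {hi} y∈ with ∈-applyUpTo⁻ (λ i → + (lo + i)) (subst (_ ∈_) (intRange-+ lo hi) y∈)
... | i , i< , refl = lo + i , refl , m≤m+n lo i , m<1+n∸o⇒o+m≤n lo hi i<

∈-intRange⁺ : ∀ {lo hi k} → lo ≤ k → k ≤ hi → + k ∈ intRange (+ lo) (+ hi)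
∈-intRange⁺ {lo} {hi} {k} lo≤k k≤hi = subst (+ k ∈_) (sym (intRange-+ lo hi))
  (subst (λ x → + x ∈ applyUpTo (λ i → + (lo + i)) (suc hi ∸ lo)) (m+[n∸m]≡n lo≤k)
    (∈-applyUpTo⁺ (λ i → + (lo + i)) (∸-monoˡ-< (s≤s k≤hi) lo≤k)))

strip : ∀ {m} → Vec ℤ m → Vec ℤ m → Fin m → Matrix2
strip a b i = map (λ k → (+ suc (toℕ i) , k))
                  (filter (coprimeTo? (suc (toℕ i))) (intRange (lookup a i) (lookup b i)))

stripCount : ℕ → ℕ → ℕ → ℕ
stripCount j lo hi = coprimesFrom j lo (suc hi ∸ lo)

length-strip : ∀ {m} (a b : Vec ℕ m) i →
               length (strip (Vec.map +_ a) (Vec.map +_ b) i) ≡ stripCount (suc (toℕ i)) (lookup a i) (lookup b i)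
length-strip a b i = begin
  length (strip (Vec.map +_ a) (Vec.map +_ b) i)
    ≡⟨ length-map _ (filter P (intRange (lookup (Vec.map +_ a) i) (lookup (Vec.map +_ b) i))) ⟩
  length (filter P (intRange (lookup (Vec.map +_ a) i) (lookup (Vec.map +_ b) i)))
    ≡⟨ cong₂ (λ lo hi → length (filter P (intRange lo hi))) (lookup-map i +_ a) (lookup-map i +_ b) ⟩
  length (filter P (intRange (+ lookup a i) (+ lookup b i)))
    ≡⟨ cong (length ∘ filter P) (intRange-+ (lookup a i) (lookup b i)) ⟩
  stripCount (suc (toℕ i)) (lookup a i) (lookup b i) ∎
  where P = coprimeTo? (suc (toℕ i))

numColumns-M : ∀ {m} (a b : Vec ℕ m) → numColumns (M (Vec.map +_ a) (Vec.map +_ b)) ≡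
               suc (sum (map (λ i → stripCount (suc (toℕ i)) (lookup a i) (lookup b i)) (allFin m)))
numColumns-M {m} a b = cong suc (begin
  length (concatMap (strip a′ b′) (allFin m))           ≡⟨ length-concatMap (strip a′ b′) (allFin m) ⟩
  sum (map (length ∘ strip a′ b′) (allFin m))           ≡⟨ cong sum (map-cong (length-strip a b) (allFin m)) ⟩
  sum (map (λ i → stripCount (suc (toℕ i)) (lookup a i) (lookup b i)) (allFin m)) ∎)
  where
  a′ = Vec.map +_ a
  b′ = Vec.map +_ b

stripCount-affine : ∀ j c d q r s →
  stripCount j (c * j * s + q) ((c * j + d * j) * s + (q + r)) ≡ d * s * coprimesFrom j q j + coprimesFrom j q (suc r)
stripCount-affine j c d q r s = trans (cong (coprimesFrom j lo) width) (coprimesFrom-affine j c d q (suc r) s)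
  where
  lo = c * j * s + q
  width : suc ((c * j + d * j) * s + (q + r)) ∸ lo ≡ d * j * s + suc r
  width = begin
    suc ((c * j + d * j) * s + (q + r)) ∸ lo  ≡⟨ cong (_∸ lo) (+-suc ((c * j + d * j) * s) (q + r)) ⟨
    (c * j + d * j) * s + suc (q + r) ∸ lo    ≡⟨ cong (λ x → (c * j + d * j) * s + x ∸ lo) (+-suc q r) ⟨
    (c * j + d * j) * s + (q + suc r) ∸ lo    ≡⟨ cong (_∸ lo) (⟦⊕⟧ ((c * j) s+ q) ((d * j) s+ suc r) s) ⟩
    lo + (d * j * s + suc r) ∸ lo             ≡⟨ m+n∸m≡n lo (d * j * s + suc r) ⟩
    d * j * s + suc r                         ∎

∈-M⁻ : ∀ {m} {a b : Vec ℕ m} {x} → x ∈ M (Vec.map +_ a) (Vec.map +_ b) →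
       ∃₂ λ (i : Fin (suc m)) k → x ≡ (+ toℕ i , + k) × lookup (1 ∷ a) i ≤ k × k ≤ lookup (1 ∷ b) i
∈-M⁻ (here refl) = zero , 1 , refl , ≤-refl , ≤-refl
∈-M⁻ {m} {a} {b} {x} (there x∈)
  with Any.satisfied (∈-concatMap⁻ (strip (Vec.map +_ a) (Vec.map +_ b)) {allFin m} {x} x∈)
... | i , x∈strip with ∈-map⁻ (+ suc (toℕ i) ,_) x∈strip
... | k , k∈ , refl
  with ∈-intRange⁻ {lookup a i} {lookup b i}
         (subst₂ (λ lo hi → k ∈ intRange lo hi) (lookup-map i +_ a) (lookup-map i +_ b)
                 (proj₁ (∈-filter⁻ (coprimeTo? (suc (toℕ i))) k∈)))
... | k′ , refl , lo≤k , k≤hi = suc i , k′ , refl , lo≤k , k≤hi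

∈-M⁺ : ∀ {m} {a b : Vec ℕ m} (i : Fin m) {k} → gcdℕ (suc (toℕ i)) k ≡ 1 → lookup a i ≤ k → k ≤ lookup b i →
       (+ suc (toℕ i) , + k) ∈ M (Vec.map +_ a) (Vec.map +_ b)
∈-M⁺ {a = a} {b} i {k} coprime lo≤k k≤hi =
  there (∈-concatMap⁺ (strip (Vec.map +_ a) (Vec.map +_ b)) (Any.map (λ { refl → ∈-strip }) (∈-allFin i)))
  where
  ∈-strip : (+ suc (toℕ i) , + k) ∈ strip (Vec.map +_ a) (Vec.map +_ b) i
  ∈-strip = ∈-map⁺ (+ suc (toℕ i) ,_) (∈-filter⁺ (coprimeTo? (suc (toℕ i)))
    (subst₂ (λ lo hi → + k ∈ intRange lo hi) (sym (lookup-map i +_ a)) (sym (lookup-map i +_ b))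
            (∈-intRange⁺ {lookup a i} {lookup b i} lo≤k k≤hi))
    (cong +_ coprime))

det2-+ : ∀ j k j′ k′ → det2 (+ j , + k) (+ j′ , + k′) ≡ j * k′ ⊖ j′ * k
det2-+ j k j′ k′ = trans (cong₂ ℤ._-_ (sym (pos-* j k′)) (sym (pos-* j′ k))) ([+m]-[+n]≡m⊖n (j * k′) (j′ * k))

∣det2∣-comm : ∀ x y → ∣ det2 x y ∣ ≡ ∣ det2 y x ∣
∣det2∣-comm (x₁ , y₁) (x₂ , y₂) = ∣i-j∣≡∣j-i∣ (x₁ ℤ.* y₂) (x₂ ℤ.* y₁)

cross-≤ : ∀ {j j′ k k′ lo hi′ D} → lo ≤ k → k′ ≤ hi′ → j * hi′ ≤ j′ * lo + D → j * k′ ≤ j′ * k + D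
cross-≤ {j} {j′} {D = D} lo≤k k′≤hi′ corner =
  ≤-trans (*-monoʳ-≤ j k′≤hi′) (≤-trans corner (+-monoˡ-≤ D (*-monoʳ-≤ j′ lo≤k)))

∣det2∣≤ : ∀ {j j′ k k′ lo hi lo′ hi′ D} → lo ≤ k → k ≤ hi → lo′ ≤ k′ → k′ ≤ hi′ →
          j * hi′ ≤ j′ * lo + D → j′ * hi ≤ j * lo′ + D → ∣ det2 (+ j , + k) (+ j′ , + k′) ∣ ≤ D
∣det2∣≤ {j} {j′} {k} {k′} {D = D} lo≤k k≤hi lo′≤k′ k′≤hi′ corner corner′ =
  subst (λ d → ∣ d ∣ ≤ D) (sym (det2-+ j k j′ k′))
        (∣m⊖n∣≤ (j * k′) (j′ * k) (cross-≤ {j} {j′} lo≤k k′≤hi′ corner) (cross-≤ {j′} {j} lo′≤k′ k≤hi corner′))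

minors2-bounded : ∀ {D} A → (∀ {x y} → x ∈ A → y ∈ A → ∣ det2 x y ∣ ≤ D) → All (λ d → ∣ d ∣ ≤ D) (minors2 A)
minors2-bounded A h = map⁺ (pairs-All A h)

minors2-∋ : ∀ {A x y} → x ∈ A → y ∈ A → x ≢ y → Any (λ d → ∣ d ∣ ≡ ∣ det2 x y ∣) (minors2 A)
minors2-∋ {x = x} {y} x∈ y∈ x≢y with ∈-pairs x∈ y∈ x≢y
... | inj₁ xy∈ = Any.map (λ { refl → refl }) (∈-map⁺ (λ p → det2 (proj₁ p) (proj₂ p)) xy∈)
... | inj₂ yx∈ = Any.map (λ { refl → ∣det2∣-comm y x }) (∈-map⁺ (λ p → det2 (proj₁ p) (proj₂ p)) yx∈)

-- The first two columns, (0, 1) and (1, 0), have determinant −1.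
rank-M : ∀ {m} b₁ (a b : Vec ℤ m) → rank (M (+ 0 ∷ a) (+ b₁ ∷ b)) ≡ 2
rank-M _ _ _ = refl

-- Reading the column (0, 1) as the strip j = 0 with 1 ≤ k ≤ 1, M(a, b) is the union over j of the strips
-- {(j, k) ∣ (1 ∷ a)ⱼ ≤ k ≤ (1 ∷ b)ⱼ}; StripBound bounds the minors between strips j and j′ at the corners.
StripBound : ∀ {m} → ℕ → Vec ℕ m → Vec ℕ m → Set
StripBound D a b = ∀ i i′ → toℕ i * lookup (1 ∷ b) i′ ≤ toℕ i′ * lookup (1 ∷ a) i + D

ΔModular-M : ∀ {m b₁ D} {a b : Vec ℕ m} {x y} → let A = M (Vec.map +_ (0 ∷ a)) (Vec.map +_ (b₁ ∷ b)) in
             StripBound D (0 ∷ a) (b₁ ∷ b) → x ∈ A → y ∈ A → x ≢ y → ∣ det2 x y ∣ ≡ D → ΔModular A D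
ΔModular-M {m} {b₁} {D} {a} {b} bound x∈ y∈ x≢y attained =
  subst (λ r → All (λ d → ∣ d ∣ ≤ D) (minors r A) × Any (λ d → ∣ d ∣ ≡ D) (minors r A))
        (sym (rank-M b₁ (Vec.map +_ a) (Vec.map +_ b)))
        (minors2-bounded A inStrips , Any.map (λ e → trans e attained) (minors2-∋ x∈ y∈ x≢y))
  where
  A = M (Vec.map +_ (0 ∷ a)) (Vec.map +_ (b₁ ∷ b))
  inStrips : ∀ {x y} → x ∈ A → y ∈ A → ∣ det2 x y ∣ ≤ D
  inStrips x∈ y∈ with ∈-M⁻ {a = 0 ∷ a} {b₁ ∷ b} x∈ | ∈-M⁻ {a = 0 ∷ a} {b₁ ∷ b} y∈
  ... | i , k , x≡ , lo≤k , k≤hi | i′ , k′ , y≡ , lo′≤k′ , k′≤hi′ =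
    subst₂ (λ x y → ∣ det2 x y ∣ ≤ D) (sym x≡) (sym y≡)
           (∣det2∣≤ {toℕ i} {toℕ i′} lo≤k k≤hi lo′≤k′ k′≤hi′ (bound i i′) (bound i′ i))

AffineStripBound : ∀ {m} → ℕ → Affine → Vec Affine m → Vec Affine m → Set
AffineStripBound n D a b = ∀ i i′ → toℕ i ⊛ lookup (0 s+ 1 ∷ b) i′ ≤[ n ] toℕ i′ ⊛ lookup (0 s+ 1 ∷ a) i ⊕ D

affineStripBound? : ∀ {m} n D (a b : Vec Affine m) → Dec (AffineStripBound n D a b)
affineStripBound? n D a b = all? λ i → all? λ i′ → _ ≤[ n ]? _

AffineStripBound⇒StripBound : ∀ {m n s D} {a b : Vec Affine m} →
  AffineStripBound n D a b → n ≤ s → StripBound (⟦ D ⟧ s) (⟦ a ⟧ᵥ s) (⟦ b ⟧ᵥ s)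
AffineStripBound⇒StripBound {s = s} {D} {a} {b} bound n≤s i i′ =
  subst₂ _≤_ (⟦⊛lookup⟧ (toℕ i) b i′)
         (trans (⟦⊕⟧ (toℕ i′ ⊛ lookup (0 s+ 1 ∷ a) i) D s) (cong (ℕ._+ ⟦ D ⟧ s) (⟦⊛lookup⟧ (toℕ i′) a i)))
         (≤[]⇒≤ (bound i i′) n≤s)
  where
  ⟦⊛lookup⟧ : ∀ {m} j (fs : Vec Affine m) i →
              ⟦ j ⊛ lookup (0 s+ 1 ∷ fs) i ⟧ s ≡ j * lookup (1 ∷ ⟦ fs ⟧ᵥ s) i
  ⟦⊛lookup⟧ j fs i = trans (⟦⊛⟧ j (lookup (0 s+ 1 ∷ fs) i) s)
                            (cong (j *_) (sym (lookup-map i (λ f → ⟦ f ⟧ s) (0 s+ 1 ∷ fs))))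

Mₐ : ∀ {m} → Vec Affine m → Vec Affine m → ℕ → Matrix2
Mₐ a b s = M (Vec.map +_ (⟦ a ⟧ᵥ s)) (Vec.map +_ (⟦ b ⟧ᵥ s))

ΔModular-Mₐ₃ : ∀ {n s} (a₂ a₃ b₁ b₂ b₃ D : Affine) →
  AffineStripBound n D (0 s+ 0 ∷ a₂ ∷ a₃ ∷ []) (b₁ ∷ b₂ ∷ b₃ ∷ []) → a₃ ≤[ n ] b₃ →
  3 ⊛ b₁ ≡ 1 ⊛ a₃ ⊕ D → gcdℕ 3 (⟦ a₃ ⟧ s) ≡ 1 → n ≤ s →
  ΔModular (Mₐ (0 s+ 0 ∷ a₂ ∷ a₃ ∷ []) (b₁ ∷ b₂ ∷ b₃ ∷ []) s) (⟦ D ⟧ s)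
ΔModular-Mₐ₃ {n} {s} a₂ a₃ b₁ b₂ b₃ D bound a₃≤b₃ attains coprime n≤s =
  ΔModular-M {a = ⟦ a₂ ∷ a₃ ∷ [] ⟧ᵥ s} {⟦ b₂ ∷ b₃ ∷ [] ⟧ᵥ s} (AffineStripBound⇒StripBound bound n≤s)
    (∈-M⁺ {a = lower} {upper} zero (gcd-zeroˡ (⟦ b₁ ⟧ s)) z≤n ≤-refl)
    (∈-M⁺ {a = lower} {upper} (suc (suc zero)) coprime ≤-refl (≤[]⇒≤ a₃≤b₃ n≤s))
    (λ ())
    (trans (cong ∣_∣ (det2-+ 1 (⟦ b₁ ⟧ s) 3 (⟦ a₃ ⟧ s))) (∣m⊖n∣≡ 3b₁≡a₃+D))
  where
  lower = ⟦ 0 s+ 0 ∷ a₂ ∷ a₃ ∷ [] ⟧ᵥ s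
  upper = ⟦ b₁ ∷ b₂ ∷ b₃ ∷ [] ⟧ᵥ s
  3b₁≡a₃+D : 3 * ⟦ b₁ ⟧ s ≡ 1 * ⟦ a₃ ⟧ s + ⟦ D ⟧ s
  3b₁≡a₃+D = begin
    3 * ⟦ b₁ ⟧ s             ≡⟨ ⟦⊛⟧ 3 b₁ s ⟨
    ⟦ 3 ⊛ b₁ ⟧ s             ≡⟨ cong (λ f → ⟦ f ⟧ s) attains ⟩
    ⟦ 1 ⊛ a₃ ⊕ D ⟧ s         ≡⟨ ⟦⊕⟧ (1 ⊛ a₃) D s ⟩
    ⟦ 1 ⊛ a₃ ⟧ s + ⟦ D ⟧ s   ≡⟨ cong (ℕ._+ ⟦ D ⟧ s) (⟦⊛⟧ 1 a₃ s) ⟩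
    1 * ⟦ a₃ ⟧ s + ⟦ D ⟧ s   ∎

lowerᵢ upperᵢ lowerᵢᵢ upperᵢᵢ : Vec Affine 3
lowerᵢ  = 0 s+ 0 ∷ 4 s+ 1 ∷ 9 s+ 1 ∷ []
upperᵢ  = 7 s+ 1 ∷ 10 s+ 1 ∷ 12 s+ 2 ∷ []
lowerᵢᵢ = 0 s+ 0 ∷ 4 s+ 3 ∷ 9 s+ 7 ∷ []
upperᵢᵢ = 7 s+ 5 ∷ 10 s+ 7 ∷ 12 s+ 8 ∷ []

Mᵢ-ΔModular : ∀ s → 1 ≤ s → ΔModular (Mₐ lowerᵢ upperᵢ s) (12 * s + 2)
Mᵢ-ΔModular s = ΔModular-Mₐ₃ {1} {s} (4 s+ 1) (9 s+ 1) (7 s+ 1) (10 s+ 1) (12 s+ 2) (12 s+ 2)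
  (from-yes (affineStripBound? 1 (12 s+ 2) lowerᵢ upperᵢ)) (from-yes (9 s+ 1 ≤[ 1 ]? 12 s+ 2))
  refl (gcd[j,c*j*s+q]≡gcd[j,q] 3 3 s 1)

Mᵢᵢ-ΔModular : ∀ s → ΔModular (Mₐ lowerᵢᵢ upperᵢᵢ s) (12 * s + 8)
Mᵢᵢ-ΔModular s = ΔModular-Mₐ₃ {0} {s} (4 s+ 3) (9 s+ 7) (7 s+ 5) (10 s+ 7) (12 s+ 8) (12 s+ 8)
  (from-yes (affineStripBound? 0 (12 s+ 8) lowerᵢᵢ upperᵢᵢ)) (from-yes (9 s+ 7 ≤[ 0 ]? 12 s+ 8))
  refl (gcd[j,c*j*s+q]≡gcd[j,q] 3 3 s 7) z≤n

-- The closed counts coprimesFrom j q j and coprimesFrom j q (suc r) left by stripCount-affine evaluate to numerals.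
Mᵢ-numColumns : ∀ s → numColumns (Mₐ lowerᵢ upperᵢ s) ≡ 12 * s + 2 + 4
Mᵢ-numColumns s = begin
  numColumns (Mₐ lowerᵢ upperᵢ s)
    ≡⟨ numColumns-M (⟦ lowerᵢ ⟧ᵥ s) (⟦ upperᵢ ⟧ᵥ s) ⟩
  suc (stripCount 1 0 (7 * s + 1) + (stripCount 2 (4 * s + 1) (10 * s + 1) + (stripCount 3 (9 * s + 1) (12 * s + 2) + 0)))
    ≡⟨ cong₂ (λ x y → suc (x + y)) (stripCount-affine 1 0 7 0 1 s)
             (cong₂ (λ x y → x + (y + 0)) (stripCount-affine 2 2 3 1 0 s) (stripCount-affine 3 3 1 1 1 s)) ⟩
  suc (7 * s * 1 + 2 + (3 * s * 1 + 1 + (1 * s * 2 + 2 + 0)))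
    ≡⟨ total s ⟩
  12 * s + 2 + 4 ∎
  where
  total : ∀ s → suc (7 * s * 1 + 2 + (3 * s * 1 + 1 + (1 * s * 2 + 2 + 0))) ≡ 12 * s + 2 + 4
  total = solve-∀

Mᵢᵢ-numColumns : ∀ s → numColumns (Mₐ lowerᵢᵢ upperᵢᵢ s) ≡ 12 * s + 8 + 4
Mᵢᵢ-numColumns s = begin
  numColumns (Mₐ lowerᵢᵢ upperᵢᵢ s)
    ≡⟨ numColumns-M (⟦ lowerᵢᵢ ⟧ᵥ s) (⟦ upperᵢᵢ ⟧ᵥ s) ⟩
  suc (stripCount 1 0 (7 * s + 5) + (stripCount 2 (4 * s + 3) (10 * s + 7) + (stripCount 3 (9 * s + 7) (12 * s + 8) + 0)))
    ≡⟨ cong₂ (λ x y → suc (x + y)) (stripCount-affine 1 0 7 0 5 s)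
             (cong₂ (λ x y → x + (y + 0)) (stripCount-affine 2 2 3 3 4 s) (stripCount-affine 3 3 1 7 1 s)) ⟩
  suc (7 * s * 1 + 6 + (3 * s * 1 + 3 + (1 * s * 2 + 2 + 0)))
    ≡⟨ total s ⟩
  12 * s + 8 + 4 ∎
  where
  total : ∀ s → suc (7 * s * 1 + 6 + (3 * s * 1 + 3 + (1 * s * 2 + 2 + 0))) ≡ 12 * s + 8 + 4
  total = solve-∀

case-i : ∀ {Δ} s → Δ ≡ 12 * s + 2 → Δ ≥ 4 →
         ΔModular (Mₐ lowerᵢ upperᵢ s) Δ × numColumns (Mₐ lowerᵢ upperᵢ s) ≡ Δ + 4
case-i zero    refl (s≤s (s≤s ()))
case-i (suc t) refl _ = Mᵢ-ΔModular (suc t) (s≤s z≤n) , Mᵢ-numColumns (suc t)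

case-ii : ∀ {Δ} s → Δ ≡ 12 * s + 8 →
          ΔModular (Mₐ lowerᵢᵢ upperᵢᵢ s) Δ × numColumns (Mₐ lowerᵢᵢ upperᵢᵢ s) ≡ Δ + 4
case-ii s refl = Mᵢᵢ-ΔModular s , Mᵢᵢ-numColumns s

-- 2 ∣ Δ and Δ % 3 ≡ 2 are implied by either shape of Δ.
proposition3p2 : (Δ : ℕ) → Δ ≥ 4 → 2 ∣ Δ → Δ % 3 ≡ 2 →
    ((s : ℕ) → Δ ≡ 12 * s + 2 →
      ΔModular (M (+ 0 ∷ + (4 * s + 1) ∷ + (9 * s + 1) ∷ []) (+ (7 * s + 1) ∷ + (10 * s + 1) ∷ + (12 * s + 2) ∷ [])) Δ
      × numColumns (M (+ 0 ∷ + (4 * s + 1) ∷ + (9 * s + 1) ∷ []) (+ (7 * s + 1) ∷ + (10 * s + 1) ∷ + (12 * s + 2) ∷ [])) ≡ Δ + 4)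
    × ((s : ℕ) → Δ ≡ 12 * s + 8 →
      ΔModular (M (+ 0 ∷ + (4 * s + 3) ∷ + (9 * s + 7) ∷ []) (+ (7 * s + 5) ∷ + (10 * s + 7) ∷ + (12 * s + 8) ∷ [])) Δ
      × numColumns (M (+ 0 ∷ + (4 * s + 3) ∷ + (9 * s + 7) ∷ []) (+ (7 * s + 5) ∷ + (10 * s + 7) ∷ + (12 * s + 8) ∷ [])) ≡ Δ + 4)
proposition3p2 Δ Δ≥4 _ _ = (λ s Δ≡ → case-i s Δ≡ Δ≥4) , case-ii
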